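{- Let $r$, $n$, $t$ be positive integers with $2\le t\le r-1$ and $n=3r-t$. Then: (1) if $t\le \frac{r+5}{5}$, then $\rho_2(n,r)=3$; (2) if $\frac{r+5}{5}<t\le \frac{2r+9}{9}$, then $\rho_2(n,r)=4$.
   Context: For integers $n\ge 2r\ge 2$, the Kneser graph $K(n,r)$ has as vertices the $r$-element subsets of $[n]=\{1,\dots,n\}$, two vertices being adjacent iff they are disjoint. A 2-packing of a graph is a set of vertices that are pairwise at distance at least $3$ (no two adjacent and no two with a common neighbor); $\rho_2(n,r)$ is the maximum cardinality of a 2-packing of $K(n,r)$. -}

module Defs where

open import Data.Nat using (ℕ)
open import Data.Fin.Subset using (Subset; ∣_∣; _∩_; Empty)
open import Data.List using (List; length)
open import Data.List.Membership.Propositional using (_∈_)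
open import Data.List.Relation.Unary.All using (All)
open import Data.List.Relation.Unary.Unique.Propositional using (Unique)
open import Data.Product using (Σ; _×_; ∃)
open import Relation.Binary.PropositionalEquality using (_≡_; _≢_)
open import Relation.Nullary using (¬_)

-- Vertices of the Kneser graph K(n,r): r-element subsets of [n] (modelled as Fin n).
IsVertex : (n r : ℕ) → Subset n → Set
IsVertex n r s = ∣ s ∣ ≡ r

Adjacent : {n : ℕ} → Subset n → Subset n → Set
Adjacent u v = Empty (u ∩ v)

CommonNeighbour : (n r : ℕ) → Subset n → Subset n → Set
CommonNeighbour n r u v = Σ (Subset n) λ w → IsVertex n r w × Adjacent u w × Adjacent v w

Is2Packing : (n r : ℕ) → List (Subset n) → Set
Is2Packing n r P =
  Unique P × All (IsVertex n r) P ×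
  (∀ {u v} → u ∈ P → v ∈ P → u ≢ v → ¬ Adjacent u v × ¬ CommonNeighbour n r u v)

ρ₂≡ : (n r k : ℕ) → Set
ρ₂≡ n r k =
  (∃ λ P → Is2Packing n r P × length P ≡ k) ×
  (∀ P → Is2Packing n r P → length P Data.Nat.≤ k)

{-# OPTIONS --safe #-}
-- With n = 3r − t, the complement of u ∪ v has n − 2r + |u ∩ v| points, so two r-sets have a
-- common neighbour exactly when |u ∩ v| ≥ t: a 2-packing of K(n,r) is a family of r-sets whose
-- pairwise intersections have size in [1, t). For k such sets the Bonferroni inequality
-- Σ|Aᵢ| ≤ n + Σ_{i<j} |Aᵢ ∩ Aⱼ| gives kr + C(k,2) ≤ n + C(k,2)·t, which fails for k = 4 when
-- 5t ≤ r + 5 and for k = 5 when 9t ≤ 2r + 9. Three r-sets sharing a core of t − 1 points attain 3,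
-- and when 5t > r + 5 four r-sets built on the edges of K₄, any two sharing one block of t − 1
-- points, attain 4.
module Submission where

open import Defs
open import Data.Bool using (Bool; true; false; _∧_)
open import Data.Empty using (⊥-elim)
open import Data.Fin.Subset
  using (Subset; inside; outside; ∣_∣; _∩_; _∪_; ∁; ⋃; ⊥; _⊆_; Empty)
open import Data.Fin.Subset.Properties
open import Data.Nat using (ℕ; zero; suc; _+_; _*_; _≤_; _<_; z≤n; s≤s; _≤?_)
open import Data.Nat.Properties
open import Data.Nat.Combinatorics using (_C_; nC1≡n; nCk+nC[k+1]≡[n+1]C[k+1])
open import Data.Nat.ListAction using (sum)
open import Data.Nat.Tactic.RingSolver using (solve-∀)
open import Data.List using (List; []; _∷_; length; take; map)
open import Data.List.Properties using (length-take)
open import Data.List.Membership.Propositional using (_∈_)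
open import Data.List.Membership.Propositional.Properties using (∈-AllPairs₂)
open import Data.List.Relation.Unary.All as All using (All; []; _∷_)
open import Data.List.Relation.Unary.All.Properties as All using (take⁺)
open import Data.List.Relation.Unary.AllPairs as AllPairs using (AllPairs; []; _∷_)
open import Data.List.Relation.Unary.AllPairs.Properties as AllPairs using (take⁺)
open import Data.List.Relation.Unary.Any using (here; there)
open import Data.List.Relation.Unary.Unique.Propositional using (Unique)
open import Data.Vec as Vec using (Vec; []; _∷_; replicate; _++_; zipWith)
open import Data.Vec.Properties using (zipWith-++; zipWith-replicate)
open import Data.Product using (∃; _×_; _,_; proj₁; proj₂)
open import Data.Sum using (inj₁; inj₂; [_,_]′)
open import Function using (id)
open import Function.Bundles using (_⇔_; mk⇔; Equivalence)
open import Relation.Nullary using (¬_; yes; no)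
open import Relation.Binary.PropositionalEquality

private variable
  n r t : ℕ

∣p∪q∣+∣p∩q∣≡∣p∣+∣q∣ : ∀ (p q : Subset n) → ∣ p ∪ q ∣ + ∣ p ∩ q ∣ ≡ ∣ p ∣ + ∣ q ∣
∣p∪q∣+∣p∩q∣≡∣p∣+∣q∣ []            []            = refl
∣p∪q∣+∣p∩q∣≡∣p∣+∣q∣ (inside  ∷ p) (inside  ∷ q) =
  cong suc (trans (+-suc _ _) (trans (cong suc (∣p∪q∣+∣p∩q∣≡∣p∣+∣q∣ p q)) (sym (+-suc _ _))))
∣p∪q∣+∣p∩q∣≡∣p∣+∣q∣ (inside  ∷ p) (outside ∷ q) = cong suc (∣p∪q∣+∣p∩q∣≡∣p∣+∣q∣ p q)
∣p∪q∣+∣p∩q∣≡∣p∣+∣q∣ (outside ∷ p) (inside  ∷ q) =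
  trans (cong suc (∣p∪q∣+∣p∩q∣≡∣p∣+∣q∣ p q)) (sym (+-suc _ _))
∣p∪q∣+∣p∩q∣≡∣p∣+∣q∣ (outside ∷ p) (outside ∷ q) = ∣p∪q∣+∣p∩q∣≡∣p∣+∣q∣ p q

∣p∪q∣≤∣p∣+∣q∣ : ∀ (p q : Subset n) → ∣ p ∪ q ∣ ≤ ∣ p ∣ + ∣ q ∣
∣p∪q∣≤∣p∣+∣q∣ p q = ≤-trans (m≤m+n _ _) (≤-reflexive (∣p∪q∣+∣p∩q∣≡∣p∣+∣q∣ p q))

∣∁p∣+∣p∣≡n : ∀ (p : Subset n) → ∣ ∁ p ∣ + ∣ p ∣ ≡ n
∣∁p∣+∣p∣≡n {n} p = trans (cong (_+ ∣ p ∣) (∣∁p∣≡n∸∣p∣ p)) (m∸n+n≡m (∣p∣≤n p))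

⊆-withSize : ∀ (p : Subset n) {k} → k ≤ ∣ p ∣ → ∃ λ q → q ⊆ p × ∣ q ∣ ≡ k
⊆-withSize {n} p {zero} _ = ⊥ , ⊥⊆ , ∣⊥∣≡0 n
⊆-withSize (inside ∷ p) {suc k} (s≤s k≤∣p∣) with ⊆-withSize p k≤∣p∣
... | q , q⊆p , ∣q∣≡k = inside ∷ q , in⊆in q⊆p , cong suc ∣q∣≡k
⊆-withSize (outside ∷ p) {suc k} k<∣p∣ with ⊆-withSize p k<∣p∣
... | q , q⊆p , ∣q∣≡k = outside ∷ q , out⊆ q⊆p , ∣q∣≡k

Empty[p∩q]⇒q⊆∁p : ∀ {p q : Subset n} → Empty (p ∩ q) → q ⊆ ∁ p
Empty[p∩q]⇒q⊆∁p {p = p} p∩q≡∅ {x} x∈q with x ∈? p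
... | yes x∈p = ⊥-elim (p∩q≡∅ (x , x∈p∩q⁺ (x∈p , x∈q)))
... | no  x∉p = x∉p⇒x∈∁p x∉p

q⊆∁p⇒Empty[p∩q] : ∀ {p q : Subset n} → q ⊆ ∁ p → Empty (p ∩ q)
q⊆∁p⇒Empty[p∩q] {p = p} {q} q⊆∁p (x , x∈p∩q) with x∈p∩q⁻ p q x∈p∩q
... | x∈p , x∈q = x∈∁p⇒x∉p (q⊆∁p x∈q) x∈p

Empty-∪⁺ : ∀ {p q : Subset n} → Empty p → Empty q → Empty (p ∪ q)
Empty-∪⁺ {p = p} {q} p≡∅ q≡∅ (x , x∈p∪q) with x∈p∪q⁻ p q x∈p∪q
... | inj₁ x∈p = p≡∅ (x , x∈p)
... | inj₂ x∈q = q≡∅ (x , x∈q)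

Empty-∪⁻ : ∀ {p q : Subset n} → Empty (p ∪ q) → Empty p × Empty q
Empty-∪⁻ p∪q≡∅ = (λ (x , x∈p) → p∪q≡∅ (x , x∈p∪q⁺ (inj₁ x∈p)))
               , (λ (x , x∈q) → p∪q≡∅ (x , x∈p∪q⁺ (inj₂ x∈q)))

Adjacent⇒∣∩∣≡0 : ∀ {u v : Subset n} → Adjacent u v → ∣ u ∩ v ∣ ≡ 0
Adjacent⇒∣∩∣≡0 {n} adj = trans (cong ∣_∣ (Empty-unique adj)) (∣⊥∣≡0 n)

∣∁[p∪q]∣+∣p∣+∣q∣≡n+∣p∩q∣ : ∀ (p q : Subset n) → ∣ ∁ (p ∪ q) ∣ + (∣ p ∣ + ∣ q ∣) ≡ n + ∣ p ∩ q ∣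
∣∁[p∪q]∣+∣p∣+∣q∣≡n+∣p∩q∣ {n} p q = begin
  ∣ ∁ (p ∪ q) ∣ + (∣ p ∣ + ∣ q ∣)             ≡⟨ cong (∣ ∁ (p ∪ q) ∣ +_) (∣p∪q∣+∣p∩q∣≡∣p∣+∣q∣ p q) ⟨
  ∣ ∁ (p ∪ q) ∣ + (∣ p ∪ q ∣ + ∣ p ∩ q ∣)     ≡⟨ +-assoc (∣ ∁ (p ∪ q) ∣) (∣ p ∪ q ∣) (∣ p ∩ q ∣) ⟨
  ∣ ∁ (p ∪ q) ∣ + ∣ p ∪ q ∣ + ∣ p ∩ q ∣       ≡⟨ cong (_+ ∣ p ∩ q ∣) (∣∁p∣+∣p∣≡n (p ∪ q)) ⟩
  n + ∣ p ∩ q ∣                               ∎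
  where open ≡-Reasoning

commonNeighbour⇔r≤∣∁[u∪v]∣ : ∀ (u v : Subset n) → CommonNeighbour n r u v ⇔ r ≤ ∣ ∁ (u ∪ v) ∣
commonNeighbour⇔r≤∣∁[u∪v]∣ {n} {r} u v = mk⇔ to from
  where
  to : CommonNeighbour n r u v → r ≤ ∣ ∁ (u ∪ v) ∣
  to (w , ∣w∣≡r , u∩w≡∅ , v∩w≡∅) =
    subst (_≤ ∣ ∁ (u ∪ v) ∣) ∣w∣≡r (p⊆q⇒∣p∣≤∣q∣ (Empty[p∩q]⇒q⊆∁p
      (subst Empty (sym (∩-distribʳ-∪ w u v)) (Empty-∪⁺ u∩w≡∅ v∩w≡∅))))
  from : r ≤ ∣ ∁ (u ∪ v) ∣ → CommonNeighbour n r u v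
  from r≤∣∁[u∪v]∣ with ⊆-withSize (∁ (u ∪ v)) r≤∣∁[u∪v]∣
  ... | w , w⊆∁[u∪v] , ∣w∣≡r =
    w , ∣w∣≡r , Empty-∪⁻ (subst Empty (∩-distribʳ-∪ w u v) (q⊆∁p⇒Empty[p∩q] w⊆∁[u∪v]))

commonNeighbour⇔t≤∣u∩v∣ : ∀ {u v : Subset n} → n + t ≡ 3 * r → IsVertex n r u → IsVertex n r v →
                          CommonNeighbour n r u v ⇔ t ≤ ∣ u ∩ v ∣
commonNeighbour⇔t≤∣u∩v∣ {n} {t} {r} {u} {v} n+t≡3r ∣u∣≡r ∣v∣≡r = mk⇔
  (λ cn → +-cancelˡ-≤ n t (∣ u ∩ v ∣) (begin
    n + t                    ≡⟨ trans n+t≡3r (3r≡r+2r r) ⟩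
    r + (r + r)              ≤⟨ +-monoˡ-≤ (r + r) (Equivalence.to (commonNeighbour⇔r≤∣∁[u∪v]∣ u v) cn) ⟩
    ∣ ∁ (u ∪ v) ∣ + (r + r)  ≡⟨ complement-count ⟩
    n + ∣ u ∩ v ∣            ∎))
  (λ t≤∣u∩v∣ → Equivalence.from (commonNeighbour⇔r≤∣∁[u∪v]∣ u v) (+-cancelʳ-≤ (r + r) r _ (begin
    r + (r + r)              ≡⟨ trans n+t≡3r (3r≡r+2r r) ⟨
    n + t                    ≤⟨ +-monoʳ-≤ n t≤∣u∩v∣ ⟩
    n + ∣ u ∩ v ∣            ≡⟨ complement-count ⟨
    ∣ ∁ (u ∪ v) ∣ + (r + r)  ∎)))
  where
  open ≤-Reasoning
  3r≡r+2r : ∀ r → 3 * r ≡ r + (r + r)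
  3r≡r+2r = solve-∀
  complement-count : ∣ ∁ (u ∪ v) ∣ + (r + r) ≡ n + ∣ u ∩ v ∣
  complement-count = subst₂ (λ a b → ∣ ∁ (u ∪ v) ∣ + (a + b) ≡ n + ∣ u ∩ v ∣) ∣u∣≡r ∣v∣≡r
                       (∣∁[p∪q]∣+∣p∣+∣q∣≡n+∣p∩q∣ u v)

SmallOverlap : ℕ → Subset n → Subset n → Set
SmallOverlap t u v = ∣ u ∩ v ∣ < t

ModerateOverlap : ℕ → Subset n → Subset n → Set
ModerateOverlap t u v = 0 < ∣ u ∩ v ∣ × ∣ u ∩ v ∣ < t

ModerateOverlap-sym : ∀ {u v : Subset n} → ModerateOverlap t u v → ModerateOverlap t v u
ModerateOverlap-sym {t = t} {u} {v} = subst (λ w → 0 < ∣ w ∣ × ∣ w ∣ < t) (∩-comm u v)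

AllPairs-tabulate : ∀ {A : Set} {R : A → A → Set} {xs : List A} →
                    Unique xs → (∀ {x y} → x ∈ xs → y ∈ xs → x ≢ y → R x y) → AllPairs R xs
AllPairs-tabulate []                 _ = []
AllPairs-tabulate (x≢xs ∷ unique-xs) R-distinct =
  All.tabulate (λ y∈xs → R-distinct (here refl) (there y∈xs) (All.lookup x≢xs y∈xs))
  ∷ AllPairs-tabulate unique-xs (λ x∈ y∈ → R-distinct (there x∈) (there y∈))

2packing⇒SmallOverlaps : ∀ {P} → n + t ≡ 3 * r → Is2Packing n r P → AllPairs (SmallOverlap t) P
2packing⇒SmallOverlaps n+t≡3r (unique , vertices , apart) =
  AllPairs-tabulate unique λ u∈P v∈P u≢v →
    ≰⇒> (λ t≤∣u∩v∣ → proj₂ (apart u∈P v∈P u≢v) (Equivalence.from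
      (commonNeighbour⇔t≤∣u∩v∣ n+t≡3r (All.lookup vertices u∈P) (All.lookup vertices v∈P)) t≤∣u∩v∣))

SmallOverlaps⇒Unique : ∀ {P : List (Subset n)} → All (λ u → t ≤ ∣ u ∣) P → AllPairs (SmallOverlap t) P →
                       Unique P
SmallOverlaps⇒Unique []              []                = []
SmallOverlaps⇒Unique (t≤∣u∣ ∷ large) (u-small ∷ small) =
  All.map (λ { {u} ∣u∩u∣<t refl → <⇒≱ ∣u∩u∣<t (subst (_ ≤_) (sym (cong ∣_∣ (∩-idem u))) t≤∣u∣) }) u-small
  ∷ SmallOverlaps⇒Unique large small

ModerateOverlap⇒apart : ∀ {u v : Subset n} → n + t ≡ 3 * r → IsVertex n r u → IsVertex n r v →
                        ModerateOverlap t u v → ¬ Adjacent u v × ¬ CommonNeighbour n r u v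
ModerateOverlap⇒apart n+t≡3r ∣u∣≡r ∣v∣≡r (0<∣u∩v∣ , ∣u∩v∣<t) =
  (λ adj → <⇒≢ 0<∣u∩v∣ (sym (Adjacent⇒∣∩∣≡0 adj))) ,
  (λ cn → <⇒≱ ∣u∩v∣<t (Equivalence.to (commonNeighbour⇔t≤∣u∩v∣ n+t≡3r ∣u∣≡r ∣v∣≡r) cn))

ModerateOverlaps⇒2packing : ∀ {P} → n + t ≡ 3 * r → t ≤ r → All (IsVertex n r) P →
                            AllPairs (ModerateOverlap t) P → Is2Packing n r P
ModerateOverlaps⇒2packing {n} {t} {r} {P} n+t≡3r t≤r vertices moderate =
  SmallOverlaps⇒Unique (All.map (λ ∣u∣≡r → subst (t ≤_) (sym ∣u∣≡r) t≤r) vertices)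
                       (AllPairs.map proj₂ moderate) ,
  vertices ,
  apart
  where
  apart : ∀ {u v} → u ∈ P → v ∈ P → u ≢ v → ¬ Adjacent u v × ¬ CommonNeighbour n r u v
  apart {u} {v} u∈P v∈P u≢v with ∈-AllPairs₂ moderate u∈P v∈P
  ... | inj₁ u≡v       = ⊥-elim (u≢v u≡v)
  ... | inj₂ uv-or-vu  = ModerateOverlap⇒apart n+t≡3r (All.lookup vertices u∈P) (All.lookup vertices v∈P)
                           ([ id , ModerateOverlap-sym {u = v} {u} ]′ uv-or-vu)

totalSize : List (Subset n) → ℕ
totalSize P = sum (map ∣_∣ P)

overlapSum : List (Subset n) → ℕ
overlapSum []      = 0
overlapSum (u ∷ P) = sum (map (λ v → ∣ u ∩ v ∣) P) + overlapSum P

∣p∩⋃Q∣≤Σ∣p∩q∣ : ∀ (p : Subset n) Q → ∣ p ∩ ⋃ Q ∣ ≤ sum (map (λ q → ∣ p ∩ q ∣) Q)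
∣p∩⋃Q∣≤Σ∣p∩q∣ {n} p []      = ≤-reflexive (trans (cong ∣_∣ (∩-zeroʳ p)) (∣⊥∣≡0 n))
∣p∩⋃Q∣≤Σ∣p∩q∣     p (q ∷ Q) = begin
  ∣ p ∩ (q ∪ ⋃ Q) ∣              ≡⟨ cong ∣_∣ (∩-distribˡ-∪ p q (⋃ Q)) ⟩
  ∣ (p ∩ q) ∪ (p ∩ ⋃ Q) ∣        ≤⟨ ∣p∪q∣≤∣p∣+∣q∣ (p ∩ q) (p ∩ ⋃ Q) ⟩
  ∣ p ∩ q ∣ + ∣ p ∩ ⋃ Q ∣        ≤⟨ +-monoʳ-≤ (∣ p ∩ q ∣) (∣p∩⋃Q∣≤Σ∣p∩q∣ p Q) ⟩
  ∣ p ∩ q ∣ + sum (map (λ q → ∣ p ∩ q ∣) Q) ∎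
  where open ≤-Reasoning

totalSize≤∣⋃∣+overlapSum : ∀ (P : List (Subset n)) → totalSize P ≤ ∣ ⋃ P ∣ + overlapSum P
totalSize≤∣⋃∣+overlapSum []      = z≤n
totalSize≤∣⋃∣+overlapSum (u ∷ P) = begin
  ∣ u ∣ + totalSize P                          ≤⟨ +-monoʳ-≤ (∣ u ∣) (totalSize≤∣⋃∣+overlapSum P) ⟩
  ∣ u ∣ + (∣ ⋃ P ∣ + overlapSum P)             ≡⟨ +-assoc (∣ u ∣) (∣ ⋃ P ∣) (overlapSum P) ⟨
  ∣ u ∣ + ∣ ⋃ P ∣ + overlapSum P               ≡⟨ cong (_+ overlapSum P) (∣p∪q∣+∣p∩q∣≡∣p∣+∣q∣ u (⋃ P)) ⟨
  ∣ u ∪ ⋃ P ∣ + ∣ u ∩ ⋃ P ∣ + overlapSum P     ≤⟨ +-monoˡ-≤ (overlapSum P)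
                                                    (+-monoʳ-≤ (∣ u ∪ ⋃ P ∣) (∣p∩⋃Q∣≤Σ∣p∩q∣ u P)) ⟩
  ∣ u ∪ ⋃ P ∣ + sum (map (λ v → ∣ u ∩ v ∣) P) + overlapSum P ≡⟨ +-assoc (∣ u ∪ ⋃ P ∣) _ (overlapSum P) ⟩
  ∣ u ∪ ⋃ P ∣ + overlapSum (u ∷ P)             ∎
  where open ≤-Reasoning

bonferroni : ∀ (P : List (Subset n)) → totalSize P ≤ n + overlapSum P
bonferroni P = ≤-trans (totalSize≤∣⋃∣+overlapSum P) (+-monoˡ-≤ (overlapSum P) (∣p∣≤n (⋃ P)))

totalSize-vertices : ∀ {P : List (Subset n)} → All (IsVertex n r) P → totalSize P ≡ length P * r
totalSize-vertices []                 = refl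
totalSize-vertices (∣u∣≡r ∷ vertices) = cong₂ _+_ ∣u∣≡r (totalSize-vertices vertices)

sum-map-<-bound : ∀ {A : Set} (f : A → ℕ) {xs : List A} → All (λ x → f x < t) xs →
                  sum (map f xs) + length xs ≤ length xs * t
sum-map-<-bound f []                             = z≤n
sum-map-<-bound {t} f {x ∷ xs} (fx<t ∷ bounded) = begin
  f x + sum (map f xs) + suc (length xs)   ≡⟨ shuffle (f x) (sum (map f xs)) (length xs) ⟩
  suc (f x) + (sum (map f xs) + length xs) ≤⟨ +-mono-≤ fx<t (sum-map-<-bound f bounded) ⟩
  t + length xs * t                        ∎
  where
  open ≤-Reasoning
  shuffle : ∀ a s l → a + s + suc l ≡ suc a + (s + l)
  shuffle = solve-∀

suc[k]C2≡k+kC2 : ∀ k → suc k C 2 ≡ k + k C 2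
suc[k]C2≡k+kC2 k = trans (sym (nCk+nC[k+1]≡[n+1]C[k+1] k 1)) (cong (_+ k C 2) (nC1≡n k))

overlapSum-bound : ∀ {P : List (Subset n)} → AllPairs (SmallOverlap t) P →
                   overlapSum P + length P C 2 ≤ (length P C 2) * t
overlapSum-bound []                                = z≤n
overlapSum-bound {t = t} {u ∷ P} (u-small ∷ small) = begin
  S + O + suc L C 2      ≡⟨ cong (S + O +_) (suc[k]C2≡k+kC2 L) ⟩
  S + O + (L + L C 2)    ≡⟨ shuffle S O L (L C 2) ⟩
  (S + L) + (O + L C 2)  ≤⟨ +-mono-≤ (sum-map-<-bound (λ v → ∣ u ∩ v ∣) u-small) (overlapSum-bound small) ⟩
  L * t + (L C 2) * t    ≡⟨ *-distribʳ-+ t L (L C 2) ⟨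
  (L + L C 2) * t        ≡⟨ cong (_* t) (suc[k]C2≡k+kC2 L) ⟨
  (suc L C 2) * t        ∎
  where
  open ≤-Reasoning
  S = sum (map (λ v → ∣ u ∩ v ∣) P)
  O = overlapSum P
  L = length P
  shuffle : ∀ s o l c → s + o + (l + c) ≡ (s + l) + (o + c)
  shuffle = solve-∀

counting-bound : ∀ {P : List (Subset n)} → All (IsVertex n r) P → AllPairs (SmallOverlap t) P →
                 length P * r + length P C 2 ≤ n + (length P C 2) * t
counting-bound {n} {r} {t} {P} vertices small = begin
  length P * r + length P C 2        ≡⟨ cong (_+ length P C 2) (totalSize-vertices vertices) ⟨
  totalSize P + length P C 2         ≤⟨ +-monoˡ-≤ (length P C 2) (bonferroni P) ⟩
  n + overlapSum P + length P C 2    ≡⟨ +-assoc n (overlapSum P) (length P C 2) ⟩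
  n + (overlapSum P + length P C 2)  ≤⟨ +-monoʳ-≤ n (overlapSum-bound small) ⟩
  n + (length P C 2) * t             ∎
  where open ≤-Reasoning

2packing-length≤ : ∀ k → n + t ≡ 3 * r → ¬ (suc k * r + suc k C 2 ≤ n + (suc k C 2) * t) →
                   ∀ P → Is2Packing n r P → length P ≤ k
2packing-length≤ {n} {t} {r} k n+t≡3r no-family P packing with length P ≤? k
... | yes length≤k = length≤k
... | no  length≰k = ⊥-elim (no-family (subst (λ l → l * r + l C 2 ≤ n + (l C 2) * t) prefix-length
        (counting-bound (All.take⁺ (suc k) (proj₁ (proj₂ packing)))
                        (AllPairs.take⁺ (suc k) (2packing⇒SmallOverlaps n+t≡3r packing)))))
  where
  prefix-length : length (take (suc k) P) ≡ suc k
  prefix-length = trans (length-take (suc k) P) (m≤n⇒m⊓n≡m (≰⇒> length≰k))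

-- The negated inequality is counting-bound for 3 + j sets, where suc c = (3 + j) C 2.
¬counting-bound : ∀ j c → n + t ≡ 3 * r → c * t ≤ j * r + c →
                  ¬ ((3 + j) * r + suc c ≤ n + suc c * t)
¬counting-bound {n} {t} {r} j c n+t≡3r ct≤jr+c fits = <-irrefl refl (begin-strict
  3 * r + (t + (j * r + c))        <⟨ n<1+n _ ⟩
  suc (3 * r + (t + (j * r + c)))  ≡⟨ regroupˡ r j c t ⟩
  (3 + j) * r + suc c + t          ≤⟨ +-monoˡ-≤ t fits ⟩
  n + suc c * t + t                ≡⟨ regroupʳ n c t ⟩
  n + t + suc c * t                ≡⟨ cong (_+ suc c * t) n+t≡3r ⟩
  3 * r + (t + c * t)              ≤⟨ +-monoʳ-≤ (3 * r) (+-monoʳ-≤ t ct≤jr+c) ⟩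
  3 * r + (t + (j * r + c))        ∎)
  where
  open ≤-Reasoning
  regroupˡ : ∀ r j c t → suc (3 * r + (t + (j * r + c))) ≡ (3 + j) * r + suc c + t
  regroupˡ = solve-∀
  regroupʳ : ∀ n c t → n + suc c * t + t ≡ n + t + suc c * t
  regroupʳ = solve-∀

blocks : ∀ {k} (sizes : Vec ℕ k) → Vec Bool k → Subset (Vec.sum sizes)
blocks []       []       = []
blocks (s ∷ ss) (b ∷ bs) = replicate s b ++ blocks ss bs

blockWeight : ∀ {k} → Vec ℕ k → Vec Bool k → ℕ
blockWeight []       []           = 0
blockWeight (s ∷ ss) (true  ∷ bs) = s + blockWeight ss bs
blockWeight (s ∷ ss) (false ∷ bs) = blockWeight ss bs

∣p++q∣≡∣p∣+∣q∣ : ∀ {m} (p : Subset m) (q : Subset n) → ∣ p ++ q ∣ ≡ ∣ p ∣ + ∣ q ∣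
∣p++q∣≡∣p∣+∣q∣ []            q = refl
∣p++q∣≡∣p∣+∣q∣ (inside  ∷ p) q = cong suc (∣p++q∣≡∣p∣+∣q∣ p q)
∣p++q∣≡∣p∣+∣q∣ (outside ∷ p) q = ∣p++q∣≡∣p∣+∣q∣ p q

∣blocks∣ : ∀ {k} (ss : Vec ℕ k) bs → ∣ blocks ss bs ∣ ≡ blockWeight ss bs
∣blocks∣ []       []           = refl
∣blocks∣ (s ∷ ss) (true  ∷ bs) =
  trans (∣p++q∣≡∣p∣+∣q∣ (replicate s true) (blocks ss bs)) (cong₂ _+_ (∣⊤∣≡n s) (∣blocks∣ ss bs))
∣blocks∣ (s ∷ ss) (false ∷ bs) =
  trans (∣p++q∣≡∣p∣+∣q∣ (replicate s false) (blocks ss bs)) (cong₂ _+_ (∣⊥∣≡0 s) (∣blocks∣ ss bs))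

blocks-∩ : ∀ {k} (ss : Vec ℕ k) bs cs → blocks ss bs ∩ blocks ss cs ≡ blocks ss (zipWith _∧_ bs cs)
blocks-∩ []       []       []       = refl
blocks-∩ (s ∷ ss) (b ∷ bs) (c ∷ cs) =
  trans (zipWith-++ _∧_ (replicate s b) (blocks ss bs) (replicate s c) (blocks ss cs))
        (cong₂ _++_ (zipWith-replicate _∧_ b c) (blocks-∩ ss bs cs))

∣blocks∩blocks∣ : ∀ {k} (ss : Vec ℕ k) bs cs →
                  ∣ blocks ss bs ∩ blocks ss cs ∣ ≡ blockWeight ss (zipWith _∧_ bs cs)
∣blocks∩blocks∣ ss bs cs = trans (cong ∣_∣ (blocks-∩ ss bs cs)) (∣blocks∣ ss (zipWith _∧_ bs cs))

blocks-vertex : ∀ {k} (ss : Vec ℕ k) bs → blockWeight ss bs ≡ r → IsVertex (Vec.sum ss) r (blocks ss bs)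
blocks-vertex ss bs weight≡r = trans (∣blocks∣ ss bs) weight≡r

blocks-overlap : ∀ {k d} (ss : Vec ℕ k) bs cs → blockWeight ss (zipWith _∧_ bs cs) ≡ d → 0 < d → d < t →
                 ModerateOverlap t (blocks ss bs) (blocks ss cs)
blocks-overlap ss bs cs weight≡d 0<d d<t =
  subst (λ m → 0 < m × m < _) (sym (trans (∣blocks∩blocks∣ ss bs cs) weight≡d)) (0<d , d<t)

module Sunflower (z p : ℕ) where

  sizes : Vec ℕ 5
  sizes = suc z ∷ p ∷ p ∷ p ∷ z ∷ []

  petal₁ petal₂ petal₃ : Vec Bool 5
  petal₁ = true ∷ true  ∷ false ∷ false ∷ false ∷ []
  petal₂ = true ∷ false ∷ true  ∷ false ∷ false ∷ []
  petal₃ = true ∷ false ∷ false ∷ true  ∷ false ∷ []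

  family : List (Subset (Vec.sum sizes))
  family = blocks sizes petal₁ ∷ blocks sizes petal₂ ∷ blocks sizes petal₃ ∷ []

  balance : Vec.sum sizes + suc (suc z) ≡ 3 * (suc z + p)
  balance = balance′ z p
    where
    balance′ : ∀ z p → suc z + (p + (p + (p + (z + 0)))) + suc (suc z) ≡ 3 * (suc z + p)
    balance′ = solve-∀

  is2Packing : 0 < p → Is2Packing (Vec.sum sizes) (suc z + p) family
  is2Packing 0<p =
    ModerateOverlaps⇒2packing balance t≤r
      (vertex petal₁ refl ∷ vertex petal₂ refl ∷ vertex petal₃ refl ∷ [])
      ( (meets petal₁ petal₂ refl ∷ meets petal₁ petal₃ refl ∷ [])
      ∷ (meets petal₂ petal₃ refl ∷ [])
      ∷ [] ∷ [])
    where
    t≤r : suc (suc z) ≤ suc z + p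
    t≤r = subst (_≤ suc z + p) (+-comm (suc z) 1) (+-monoʳ-≤ (suc z) 0<p)
    vertex : ∀ bs → blockWeight sizes bs ≡ suc z + (p + 0) →
             IsVertex (Vec.sum sizes) (suc z + p) (blocks sizes bs)
    vertex bs weight≡ = blocks-vertex sizes bs (trans weight≡ (cong (suc z +_) (+-identityʳ p)))
    meets : ∀ bs cs → blockWeight sizes (zipWith _∧_ bs cs) ≡ suc z + 0 →
            ModerateOverlap (suc (suc z)) (blocks sizes bs) (blocks sizes cs)
    meets bs cs weight≡ =
      blocks-overlap sizes bs cs (trans weight≡ (+-identityʳ (suc z))) (s≤s z≤n) (n<1+n (suc z))

-- The six d-blocks are the edges 12, 13, 14, 23, 24, 34 of K₄; star i takes the three edges at
-- vertex i and the i-th p-block, so two stars share exactly one edge. The e-block is padding.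
module EdgeDesign (d p e : ℕ) where

  sizes : Vec ℕ 11
  sizes = d ∷ d ∷ d ∷ d ∷ d ∷ d ∷ p ∷ p ∷ p ∷ p ∷ e ∷ []

  star₁ star₂ star₃ star₄ : Vec Bool 11
  star₁ = true  ∷ true  ∷ true  ∷ false ∷ false ∷ false ∷ true  ∷ false ∷ false ∷ false ∷ false ∷ []
  star₂ = true  ∷ false ∷ false ∷ true  ∷ true  ∷ false ∷ false ∷ true  ∷ false ∷ false ∷ false ∷ []
  star₃ = false ∷ true  ∷ false ∷ true  ∷ false ∷ true  ∷ false ∷ false ∷ true  ∷ false ∷ false ∷ []
  star₄ = false ∷ false ∷ true  ∷ false ∷ true  ∷ true  ∷ false ∷ false ∷ false ∷ true  ∷ false ∷ []

  family : List (Subset (Vec.sum sizes))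
  family = blocks sizes star₁ ∷ blocks sizes star₂ ∷ blocks sizes star₃ ∷ blocks sizes star₄ ∷ []

  balance : p + e + 1 ≡ 2 * d → Vec.sum sizes + suc d ≡ 3 * (3 * d + p)
  balance p+e+1≡2d = begin
    Vec.sum sizes + suc d        ≡⟨ regroup d p e ⟩
    7 * d + 3 * p + (p + e + 1)  ≡⟨ cong (7 * d + 3 * p +_) p+e+1≡2d ⟩
    7 * d + 3 * p + 2 * d        ≡⟨ collect d p ⟩
    3 * (3 * d + p)              ∎
    where
    open ≡-Reasoning
    regroup : ∀ d p e → d + (d + (d + (d + (d + (d + (p + (p + (p + (p + (e + 0)))))))))) + suc d
                        ≡ 7 * d + 3 * p + (p + e + 1)
    regroup = solve-∀
    collect : ∀ d p → 7 * d + 3 * p + 2 * d ≡ 3 * (3 * d + p)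
    collect = solve-∀

  is2Packing : 0 < d → p + e + 1 ≡ 2 * d → Is2Packing (Vec.sum sizes) (3 * d + p) family
  is2Packing 0<d p+e+1≡2d =
    ModerateOverlaps⇒2packing (balance p+e+1≡2d) t≤r
      (vertex star₁ refl ∷ vertex star₂ refl ∷ vertex star₃ refl ∷ vertex star₄ refl ∷ [])
      ( (meets star₁ star₂ refl ∷ meets star₁ star₃ refl ∷ meets star₁ star₄ refl ∷ [])
      ∷ (meets star₂ star₃ refl ∷ meets star₂ star₄ refl ∷ [])
      ∷ (meets star₃ star₄ refl ∷ [])
      ∷ [] ∷ [])
    where
    t≤r : suc d ≤ 3 * d + p
    t≤r = begin
      suc d            ≤⟨ +-monoˡ-≤ d 0<d ⟩
      d + d            ≤⟨ m≤m+n (d + d) (d + p) ⟩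
      d + d + (d + p)  ≡⟨ regroup d p ⟩
      3 * d + p        ∎
      where
      open ≤-Reasoning
      regroup : ∀ d p → d + d + (d + p) ≡ 3 * d + p
      regroup = solve-∀
    vertex : ∀ bs → blockWeight sizes bs ≡ d + (d + (d + (p + 0))) →
             IsVertex (Vec.sum sizes) (3 * d + p) (blocks sizes bs)
    vertex bs weight≡ = blocks-vertex sizes bs (trans weight≡ (three-stars d p))
      where
      three-stars : ∀ d p → d + (d + (d + (p + 0))) ≡ 3 * d + p
      three-stars = solve-∀
    meets : ∀ bs cs → blockWeight sizes (zipWith _∧_ bs cs) ≡ d + 0 →
            ModerateOverlap (suc d) (blocks sizes bs) (blocks sizes cs)
    meets bs cs weight≡ = blocks-overlap sizes bs cs (trans weight≡ (+-identityʳ d)) 0<d (n<1+n d)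

balance-unique : ∀ {m} → m + t ≡ 3 * r → n + t ≡ 3 * r → m ≡ n
balance-unique {t = t} {n = n} {m = m} m+t≡3r n+t≡3r = +-cancelʳ-≡ t m n (trans m+t≡3r (sym n+t≡3r))

3packing-exists : 2 ≤ t → t ≤ r → n + t ≡ 3 * r → ∃ λ P → Is2Packing n r P × length P ≡ 3
3packing-exists {t = suc (suc z)} {r} {n} (s≤s (s≤s z≤n)) t≤r n+t≡3r with m≤n⇒∃[o]m+o≡n t≤r
... | q , t+q≡r = subst₂ (λ n r → ∃ λ P → Is2Packing n r P × length P ≡ 3) n≡ r≡
                    (family , is2Packing (s≤s z≤n) , refl)
  where
  open Sunflower z (suc q)
  r≡ : suc z + suc q ≡ r
  r≡ = trans (cong suc (+-suc z q)) t+q≡r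
  n≡ : Vec.sum sizes ≡ n
  n≡ = balance-unique {r = r} (trans balance (cong (3 *_) r≡)) n+t≡3r

-- r + 6 + e = 5t and 9t + g = 2r + 9 force t = d + 1 and r = 3d + p for d = 2 + 2e + g, p = 3 + 3e + 2g.
edgeDesign-parameters : ∀ {r t e g} → suc (r + 5) + e ≡ 5 * t → 9 * t + g ≡ 2 * r + 9 →
                        t ≡ suc (2 + 2 * e + g) × r ≡ 3 * (2 + 2 * e + g) + (3 + 3 * e + 2 * g)
edgeDesign-parameters {r} {t} {e} {g} r+6+e≡5t 9t+g≡2r+9 = t≡ , r≡
  where
  open ≡-Reasoning
  t≡ : t ≡ suc (2 + 2 * e + g)
  t≡ = +-cancelˡ-≡ (2 * r + 9 + 9 * t) t _ (begin
    2 * r + 9 + 9 * t + t                ≡⟨ regroup r t ⟩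
    2 * (5 * t) + (2 * r + 9)            ≡⟨ cong₂ (λ x y → 2 * x + y) r+6+e≡5t 9t+g≡2r+9 ⟨
    2 * (suc (r + 5) + e) + (9 * t + g)  ≡⟨ solve r t e g ⟩
    2 * r + 9 + 9 * t + suc (2 + 2 * e + g) ∎)
    where
    regroup : ∀ r t → 2 * r + 9 + 9 * t + t ≡ 2 * (5 * t) + (2 * r + 9)
    regroup = solve-∀
    solve : ∀ r t e g → 2 * (suc (r + 5) + e) + (9 * t + g) ≡ 2 * r + 9 + 9 * t + suc (2 + 2 * e + g)
    solve = solve-∀
  r≡ : r ≡ 3 * (2 + 2 * e + g) + (3 + 3 * e + 2 * g)
  r≡ = +-cancelˡ-≡ (e + 6) r _ (begin
    e + 6 + r                  ≡⟨ reorder e r ⟩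
    suc (r + 5) + e            ≡⟨ r+6+e≡5t ⟩
    5 * t                      ≡⟨ cong (5 *_) t≡ ⟩
    5 * suc (2 + 2 * e + g)    ≡⟨ solve e g ⟩
    e + 6 + (3 * (2 + 2 * e + g) + (3 + 3 * e + 2 * g)) ∎)
    where
    reorder : ∀ e r → e + 6 + r ≡ suc (r + 5) + e
    reorder = solve-∀
    solve : ∀ e g → 5 * suc (2 + 2 * e + g) ≡ e + 6 + (3 * (2 + 2 * e + g) + (3 + 3 * e + 2 * g))
    solve = solve-∀

4packing-exists : r + 5 < 5 * t → 9 * t ≤ 2 * r + 9 → n + t ≡ 3 * r →
                  ∃ λ P → Is2Packing n r P × length P ≡ 4
4packing-exists {r} {t} {n} r+5<5t 9t≤2r+9 n+t≡3r
  with m≤n⇒∃[o]m+o≡n r+5<5t | m≤n⇒∃[o]m+o≡n 9t≤2r+9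
... | e , r+6+e≡5t | g , 9t+g≡2r+9 with edgeDesign-parameters {r} {t} {e} {g} r+6+e≡5t 9t+g≡2r+9
... | refl , refl = subst (λ n → ∃ λ P → Is2Packing n r P × length P ≡ 4) n≡
                      (family , is2Packing (s≤s z≤n) (edge-count e g) , refl)
  where
  open EdgeDesign (2 + 2 * e + g) (3 + 3 * e + 2 * g) e
  edge-count : ∀ e g → 3 + 3 * e + 2 * g + e + 1 ≡ 2 * (2 + 2 * e + g)
  edge-count = solve-∀
  n≡ : Vec.sum sizes ≡ n
  n≡ = balance-unique {r = r} (balance (edge-count e g)) n+t≡3r

mainTheorem14 : (r n t : ℕ) → 1 ≤ r → 1 ≤ n → 2 ≤ t → t + 1 ≤ r → n + t ≡ 3 * r →
    ((5 * t ≤ r + 5 → ρ₂≡ n r 3) ×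
     (r + 5 < 5 * t → 9 * t ≤ 2 * r + 9 → ρ₂≡ n r 4))
mainTheorem14 r n t _ _ 2≤t t+1≤r n+t≡3r =
  (λ 5t≤r+5 →
     3packing-exists 2≤t t≤r n+t≡3r ,
     2packing-length≤ 3 n+t≡3r (¬counting-bound {n} {t} {r} 1 5 n+t≡3r (5t≤1*r+5 5t≤r+5))) ,
  (λ r+5<5t 9t≤2r+9 →
     4packing-exists r+5<5t 9t≤2r+9 n+t≡3r ,
     2packing-length≤ 4 n+t≡3r (¬counting-bound {n} {t} {r} 2 9 n+t≡3r 9t≤2r+9))
  where
  t≤r : t ≤ r
  t≤r = ≤-trans (m≤m+n t 1) t+1≤r
  5t≤1*r+5 : 5 * t ≤ r + 5 → 5 * t ≤ 1 * r + 5
  5t≤1*r+5 = subst (λ x → 5 * t ≤ x + 5) (sym (*-identityˡ r))
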